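{- Let $\sigma\in Av(T_1)\cup Av(T_2)$ and $l\ge0$. The following are equivalent: (a) the Dyck prefix $\Phi(\sigma)$ can be decomposed as $\Phi(\sigma)=P'P''$, where $P'$ is a Dyck path of length $2l$ and $P''$ is a (possibly empty) Dyck prefix; (b) $\sigma$ is the juxtaposition $\sigma'\sigma''$, where $\sigma'$ is a permutation of the set $\{1,\dots,l\}$ and $\sigma''$ is a nonempty word. Moreover, in this case, letting $\tau\in S_{l+1}(T_1)\cup S_{l+1}(T_2)$ be the permutation obtained by appending the symbol $l+1$ at the end of $\sigma'$, and $\rho$ be the renormalization of $\sigma''$, we have $P'=\Phi(\tau)$ and $P''=\Phi(\rho)$.
   Context: A permutation $\sigma$ avoids $\tau$ if no subsequence of $\sigma$ has the same relative order as $\tau$. Let $T_1=\{3214,3241,4213,4231\}$ and $T_2=\{3124,3142,4123,4132\}$; $Av(T)$ is the set of permutations avoiding all patterns of $T$, and $S_n(T)=Av(T)\cap S_n$. The renormalization of a word of distinct integers is the permutation with the same relative order. A Dyck prefix is a lattice path starting at the origin with steps $U=(1,1)$ and $D=(1,-1)$ that never goes below the $x$-axis (a word in $U,D$); a Dyck path is a Dyck prefix ending on the $x$-axis. The map $\Phi$ from $Av(T_1)\cup Av(T_2)$ to Dyck prefixes is defined as follows. The permutation $1$ is mapped to the empty path. For $n\ge1$ and $\sigma\in S_{n+1}(T_1)\cup S_{n+1}(T_2)$, write $\sigma=M_1w_1M_2w_2\cdots M_kw_k$, where $M_1<\cdots<M_k=n+1$ are the left-to-right maxima of $\sigma$ (entries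 larger than all preceding entries) and $w_i$ is a possibly empty word of length $l_i$; set $M_0=0$. If $w_k$ is empty, $\Phi(\sigma)=U^{M_1-M_0}D^{l_1+1}U^{M_2-M_1}D^{l_2+1}\cdots U^{M_{k-1}-M_{k-2}}D^{l_{k-1}+1}$. If $w_k=x_1\cdots x_{l_k}$ is nonempty, $\Phi(\sigma)=U^{M_1-M_0}D^{l_1+1}\cdots U^{M_{k-1}-M_{k-2}}D^{l_{k-1}+1}U^{M_k-M_{k-1}}Q_1\cdots Q_{l_k-1}$, where $Q_j=U$ if $x_j=\max\{x_j,x_{j+1},\dots,x_{l_k}\}$ and $Q_j=D$ otherwise. -}

module Defs where

open import Data.Nat using (ℕ; zero; suc; _<_; _<ᵇ_; _∸_; _+_; _*_)
open import Data.Nat.Properties using (_<?_)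
open import Data.Bool using (Bool; true; false; if_then_else_)
open import Data.List using (List; []; _∷_; _++_; [_]; length; map; filter; applyUpTo; replicate)
open import Data.List.Relation.Binary.Permutation.Propositional using (_↭_)
open import Data.List.Relation.Binary.Sublist.Propositional using (_⊆_)
open import Data.List.Relation.Binary.Pointwise using (Pointwise)
open import Data.List.Relation.Unary.All using (All)
open import Data.Product using (∃; ∃-syntax; _×_)
open import Relation.Nullary using (¬_; yes; no)
open import Function.Bundles using (_⇔_)

IsPerm : ℕ → List ℕ → Set
IsPerm n w = w ↭ applyUpTo suc n

-- two words (of distinct integers) have the same relative order
data OrdIso : List ℕ → List ℕ → Set where
  [] : OrdIso [] []
  _∷_ : ∀ {x y xs ys} →
        Pointwise (λ a b → (x < a ⇔ y < b)) xs ys →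
        OrdIso xs ys → OrdIso (x ∷ xs) (y ∷ ys)

Contains : List ℕ → List ℕ → Set
Contains σ τ = ∃[ ys ] (ys ⊆ σ × OrdIso ys τ)

Avoids : List ℕ → List (List ℕ) → Set
Avoids σ T = All (λ τ → ¬ Contains σ τ) T

T₁ : List (List ℕ)
T₁ = (3 ∷ 2 ∷ 1 ∷ 4 ∷ []) ∷ (3 ∷ 2 ∷ 4 ∷ 1 ∷ []) ∷ (4 ∷ 2 ∷ 1 ∷ 3 ∷ []) ∷ (4 ∷ 2 ∷ 3 ∷ 1 ∷ []) ∷ []

T₂ : List (List ℕ)
T₂ = (3 ∷ 1 ∷ 2 ∷ 4 ∷ []) ∷ (3 ∷ 1 ∷ 4 ∷ 2 ∷ []) ∷ (4 ∷ 1 ∷ 2 ∷ 3 ∷ []) ∷ (4 ∷ 1 ∷ 3 ∷ 2 ∷ []) ∷ []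

InAvT₁∪T₂ : ℕ → List ℕ → Set
InAvT₁∪T₂ n σ = IsPerm n σ × (Avoids σ T₁ Data.Sum.⊎ Avoids σ T₂)
  where import Data.Sum

renorm : List ℕ → List ℕ
renorm w = map (λ x → suc (length (filter (_<? x) w))) w

data Step : Set where
  U D : Step

data PrefixFrom : ℕ → List Step → Set where
  []  : ∀ {h} → PrefixFrom h []
  up   : ∀ {h p} → PrefixFrom (suc h) p → PrefixFrom h (U ∷ p)
  down : ∀ {h p} → PrefixFrom h p → PrefixFrom (suc h) (D ∷ p)

data PathFrom : ℕ → List Step → Set where
  []  : PathFrom 0 []
  up   : ∀ {h p} → PathFrom (suc h) p → PathFrom h (U ∷ p)
  down : ∀ {h p} → PathFrom h p → PathFrom (suc h) (D ∷ p)

DyckPrefix : List Step → Set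
DyckPrefix = PrefixFrom 0

DyckPath : List Step → Set
DyckPath = PathFrom 0

-- decomposition σ = M₁w₁ ⋯ M_k w_k by left-to-right maxima
blocksAux : ℕ → List ℕ → List ℕ → List (ℕ × List ℕ)
blocksAux M w [] = (M Data.Product., w) ∷ []
  where import Data.Product
blocksAux M w (x ∷ xs) with M <? x
... | yes _ = (M Data.Product., w) ∷ blocksAux x [] xs
  where import Data.Product
... | no  _ = blocksAux M (w ++ [ x ]) xs

blocks : List ℕ → List (ℕ × List ℕ)
blocks [] = []
blocks (x ∷ xs) = blocksAux x [] xs

-- Q₁ ⋯ Q_{l-1} for the last word x₁ ⋯ x_l
-- every entry of the list is smaller than x
allLt : ℕ → List ℕ → Bool
allLt x [] = true
allLt x (z ∷ zs) = if z <ᵇ x then allLt x zs else false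

qs : List ℕ → List Step
qs [] = []
qs (x ∷ []) = []
qs (x ∷ y ∷ ys) = (if allLt x (y ∷ ys) then U else D) ∷ qs (y ∷ ys)

-- previous maximum M_{i-1}, remaining blocks
ΦAux : ℕ → List (ℕ × List ℕ) → List Step
ΦAux p [] = []
ΦAux p ((M Data.Product., []) ∷ []) = []
  where import Data.Product
ΦAux p ((M Data.Product., (x ∷ xs)) ∷ []) = replicate (M ∸ p) U ++ qs (x ∷ xs)
  where import Data.Product
ΦAux p ((M Data.Product., w) ∷ b ∷ bs) =
  replicate (M ∸ p) U ++ replicate (suc (length w)) D ++ ΦAux M (b ∷ bs)
  where import Data.Product

Φ : List ℕ → List Step
Φ σ = ΦAux 0 (blocks σ)

module Submission where

-- Read σ block by block, σ = M₁w₁ ⋯ M_kw_k by left-to-right maxima.  In a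
-- state where the prefix π with maximum p has been read, Φ σ is at height
-- p ∸ |π|; the next block (M, w) climbs M ∸ p and descends |w| + 1 steps,
-- ending at M ∸ |πMw|.  By pigeonhole (π has distinct entries ≤ M) this is
-- never negative, and it is 0 exactly when πMw permutes {1,…,M}; the steps
-- Q_j of the last block are too few to reach the axis.  Consequently
--   * Φ σ is a Dyck prefix, and a Dyck path P′ starting Φ σ ends after the
--     blocks of a prefix σ′ ∈ S_l with |P′| = 2l and a nonempty rest: (a) ⇒ (b);
--   * if σ = σ′σ″ with σ′ ∈ S_l, the complete blocks of σ′ give Φ(σ′ (l+1)),
--     a Dyck path of length 2l, and the blocks of σ″ shifted down by l are
--     those of renorm σ″, so Φ σ = Φ(σ′ (l+1)) Φ(renorm σ″): (b) ⇒ (a), and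
--     the factors of (a) are determined by their lengths;
--   * σ′ (l+1) has the relative order of the subword σ′y of σ (y the first
--     entry of σ″), so it avoids every pattern that σ avoids.
-- Only this last point uses pattern avoidance; everything else holds for all
-- permutations.

open import Defs
open import Data.Nat using (ℕ; zero; suc; _+_; _*_; _∸_; _≤_; _<_; _<ᵇ_; z≤n; s≤s)
open import Data.Nat.Properties
open import Data.Nat.Tactic.RingSolver using (solve-∀)
open import Data.List using (List; []; _∷_; _++_; [_]; length; map; filter; applyUpTo; replicate)
open import Data.List.Properties
  using (∷-injective; ∷-injectiveˡ; ∷-injectiveʳ; ++-assoc; ++-identityʳ; length-++; length-replicate; length-map;
         length-applyUpTo; applyUpTo-∷ʳ; map-++; map-id-local; map-cong-local; filter-++; filter-all; filter-some; filter-none)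
open import Data.List.Relation.Unary.All using (All; []; _∷_; tabulate)
import Data.List.Relation.Unary.All as All
import Data.List.Relation.Unary.All.Properties as AllP
import Data.List.Relation.Unary.Any as Any
open import Data.List.Relation.Unary.Any using (here; there)
open import Data.List.Membership.Propositional using (_∈_)
open import Data.List.Membership.Propositional.Properties using (∈-applyUpTo⁻; ∈-applyUpTo⁺; ∈-++⁺ʳ)
open import Data.List.Relation.Binary.Permutation.Propositional using (_↭_; ↭-sym)
open import Data.List.Relation.Binary.Permutation.Propositional.Properties using (↭-length; ∈-resp-↭; filter-↭; ++⁺ʳ)
open import Data.List.Relation.Binary.Pointwise using (Pointwise; []; _∷_)
open import Data.List.Relation.Binary.Sublist.Propositional using (_⊆_; _∷_; ⊆-refl; ⊆-trans)
open import Data.List.Relation.Binary.Sublist.Propositional.Properties using (map⁺; All-resp-⊆; ++⁺; []⊆-universal)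
open import Data.Product using (∃-syntax; _×_; _,_; proj₁; proj₂)
open import Data.Sum using (_⊎_; inj₁; inj₂)
import Data.Sum as Sum
open import Data.Empty using (⊥-elim)
open import Relation.Nullary using (yes; no)
open import Relation.Nullary.Reflects using (det; fromEquivalence)
open import Relation.Binary.PropositionalEquality using (_≡_; _≢_; refl; sym; trans; cong; cong₂; subst; module ≡-Reasoning)
open import Function.Bundles using (_⇔_; mk⇔; Equivalence)
open import Function.Construct.Composition using (_⇔-∘_)
open import Function.Construct.Symmetry using (⇔-sym)

path-ups : ∀ {h} a {R} → PathFrom (h + a) R → PathFrom h (replicate a U ++ R)
path-ups {h} zero {R} p = subst (λ k → PathFrom k R) (+-identityʳ h) p
path-ups {h} (suc a) {R} p = up (path-ups a (subst (λ k → PathFrom k R) (+-suc h a) p))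

prefix-ups : ∀ {h} a {R} → PrefixFrom (h + a) R → PrefixFrom h (replicate a U ++ R)
prefix-ups {h} zero {R} p = subst (λ k → PrefixFrom k R) (+-identityʳ h) p
prefix-ups {h} (suc a) {R} p = up (prefix-ups a (subst (λ k → PrefixFrom k R) (+-suc h a) p))

path-downs : ∀ {g} d {R} → d ≤ g → PathFrom (g ∸ d) R → PathFrom g (replicate d D ++ R)
path-downs zero _ p = p
path-downs {suc g} (suc d) (s≤s d≤g) p = down (path-downs d d≤g p)

prefix-downs : ∀ {g} d {R} → d ≤ g → PrefixFrom (g ∸ d) R → PrefixFrom g (replicate d D ++ R)
prefix-downs zero _ p = p
prefix-downs {suc g} (suc d) (s≤s d≤g) p = down (prefix-downs d d≤g p)

prefix-short : ∀ {g} q → length q ≤ g → PrefixFrom g q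
prefix-short [] _ = []
prefix-short (U ∷ q) q≤g = up (prefix-short q (≤-trans (n≤1+n _) (s≤s (≤-trans (n≤1+n _) q≤g))))
prefix-short {suc g} (D ∷ q) (s≤s q≤g) = down (prefix-short q q≤g)

path-height≤length : ∀ {h P} → PathFrom h P → h ≤ length P
path-height≤length [] = z≤n
path-height≤length (up p) = ≤-trans (n≤1+n _) (≤-trans (path-height≤length p) (n≤1+n _))
path-height≤length (down p) = s≤s (path-height≤length p)

prefix-after-path : ∀ {h P} R → PathFrom h P → PrefixFrom h (P ++ R) → DyckPrefix R
prefix-after-path R [] q = q
prefix-after-path R (up p) (up q) = prefix-after-path R p q
prefix-after-path R (down p) (down q) = prefix-after-path R p q

path-across-ups : ∀ {h} a {P′ P″ R} → PathFrom h P′ → P′ ++ P″ ≡ replicate a U ++ R →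
  (P′ ≡ [] × h ≡ 0) ⊎ ∃[ P₀ ] (P′ ≡ replicate a U ++ P₀ × PathFrom (h + a) P₀ × P₀ ++ P″ ≡ R)
path-across-ups {h} zero {P′} p eq = inj₂ (P′ , refl , subst (λ k → PathFrom k P′) (sym (+-identityʳ h)) p , eq)
path-across-ups (suc a) [] _ = inj₁ (refl , refl)
path-across-ups {h} (suc a) (up p) eq with path-across-ups a p (∷-injectiveʳ eq)
... | inj₁ (_ , ())
... | inj₂ (P₀ , refl , p₀ , eq₀) = inj₂ (P₀ , refl , subst (λ k → PathFrom k P₀) (sym (+-suc h a)) p₀ , eq₀)
path-across-ups (suc a) (down p) eq with ∷-injectiveˡ eq
... | ()

path-at-axis : ∀ {h} → PathFrom h [] → h ≡ 0
path-at-axis [] = refl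

path-across-downs : ∀ {g} d {P′ P″ R} → d ≤ g → PathFrom g P′ → P′ ++ P″ ≡ replicate d D ++ R →
  ∃[ P₀ ] (P′ ≡ replicate d D ++ P₀ × PathFrom (g ∸ d) P₀ × P₀ ++ P″ ≡ R)
path-across-downs zero _ p eq = _ , refl , p , eq
path-across-downs (suc d) (s≤s d≤g) (down p) eq with path-across-downs d d≤g p (∷-injectiveʳ eq)
... | P₀ , refl , p₀ , eq₀ = P₀ , refl , p₀ , eq₀
path-across-downs (suc d) _ (up p) eq with ∷-injectiveˡ eq
... | ()

path-before-ups : ∀ {h} a {P′ P″} q → PathFrom h P′ → P′ ++ P″ ≡ replicate a U ++ q →
  length q < h + a → P′ ≡ [] × h ≡ 0
path-before-ups a {P′} {P″} q p eq q<h+a with path-across-ups a p eq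
... | inj₁ empty = empty
... | inj₂ (P₀ , _ , p₀ , eq₀) = ⊥-elim (<⇒≱ q<h+a (begin
  _ + a                 ≤⟨ path-height≤length p₀ ⟩
  length P₀             ≤⟨ m≤m+n (length P₀) (length P″) ⟩
  length P₀ + length P″ ≡⟨ sym (length-++ P₀) ⟩
  length (P₀ ++ P″)     ≡⟨ cong length eq₀ ⟩
  length q              ∎))
  where open ≤-Reasoning

length-block : ∀ a d R → length (replicate a U ++ replicate d D ++ R) ≡ a + (d + length R)
length-block a d R = begin
  length (replicate a U ++ replicate d D ++ R)      ≡⟨ length-++ (replicate a U) ⟩
  length (replicate a U) + length (replicate d D ++ R)
    ≡⟨ cong₂ _+_ (length-replicate a) (length-++ (replicate d D)) ⟩
  a + (length (replicate d D) + length R)            ≡⟨ cong (λ k → a + (k + length R)) (length-replicate d) ⟩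
  a + (d + length R)                                ∎
  where open ≡-Reasoning

-- A decomposition of a word into blocks (M, w): a left-to-right maximum M
-- followed by the entries up to the next one.
Blocks : Set
Blocks = List (ℕ × List ℕ)

flatten : Blocks → List ℕ
flatten [] = []
flatten ((M , w) ∷ bs) = M ∷ w ++ flatten bs

data LRMaxima : ℕ → Blocks → Set where
  []    : ∀ {p} → LRMaxima p []
  block : ∀ {p M w bs} → p < M → All (_≤ M) w → LRMaxima M bs → LRMaxima p ((M , w) ∷ bs)

lastMax : ℕ → Blocks → ℕ
lastMax p [] = p
lastMax p ((M , _) ∷ bs) = lastMax M bs

blocksAux-nonempty : ∀ M w ys → ∃[ b ] ∃[ bs ] (blocksAux M w ys ≡ b ∷ bs)
blocksAux-nonempty M w [] = _ , _ , refl
blocksAux-nonempty M w (y ∷ ys) with M <? y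
... | yes _ = _ , _ , refl
... | no _ = blocksAux-nonempty M (w ++ [ y ]) ys

flatten-blocksAux : ∀ M w ys → flatten (blocksAux M w ys) ≡ M ∷ w ++ ys
flatten-blocksAux M w [] = refl
flatten-blocksAux M w (y ∷ ys) with M <? y
... | yes _ = cong (λ t → M ∷ w ++ t) (flatten-blocksAux y [] ys)
... | no _ = trans (flatten-blocksAux M (w ++ [ y ]) ys) (cong (M ∷_) (++-assoc w [ y ] ys))

flatten-blocks : ∀ σ → flatten (blocks σ) ≡ σ
flatten-blocks [] = refl
flatten-blocks (x ∷ xs) = flatten-blocksAux x [] xs

blocksAux-LRMaxima : ∀ {p} M w ys → p < M → All (_≤ M) w → LRMaxima p (blocksAux M w ys)
blocksAux-LRMaxima M w [] p<M w≤M = block p<M w≤M []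
blocksAux-LRMaxima M w (y ∷ ys) p<M w≤M with M <? y
... | yes M<y = block p<M w≤M (blocksAux-LRMaxima y [] ys M<y [])
... | no M≮y = blocksAux-LRMaxima M (w ++ [ y ]) ys p<M (AllP.++⁺ w≤M (≮⇒≥ M≮y ∷ []))

blocksAux-++ : ∀ M w xs y ys → M < y → All (_< y) xs →
  blocksAux M w (xs ++ y ∷ ys) ≡ blocksAux M w xs ++ blocksAux y [] ys
blocksAux-++ M w [] y ys M<y [] with M <? y
... | yes _ = refl
... | no M≮y = ⊥-elim (M≮y M<y)
blocksAux-++ M w (x ∷ xs) y ys M<y (x<y ∷ xs<y) with M <? x
... | yes _ = cong ((M , w) ∷_) (blocksAux-++ x [] xs y ys x<y xs<y)
... | no _ = blocksAux-++ M (w ++ [ x ]) xs y ys M<y xs<y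

blocks-++ : ∀ xs y ys → All (_< y) xs → blocks (xs ++ y ∷ ys) ≡ blocks xs ++ blocksAux y [] ys
blocks-++ [] y ys [] = refl
blocks-++ (x ∷ xs) y ys (x<y ∷ xs<y) = blocksAux-++ x [] xs y ys x<y xs<y

lastMax-blocksAux : ∀ p M w xs →
  All (_≤ lastMax p (blocksAux M w xs)) (M ∷ xs) × lastMax p (blocksAux M w xs) ∈ M ∷ xs
lastMax-blocksAux p M w [] = ≤-refl ∷ [] , here refl
lastMax-blocksAux p M w (x ∷ xs) with M <? x
... | yes M<x with lastMax-blocksAux M x [] xs
...   | (x≤L ∷ xs≤L) , L∈ = (≤-trans (<⇒≤ M<x) x≤L ∷ x≤L ∷ xs≤L) , there L∈
lastMax-blocksAux p M w (x ∷ xs) | no M≮x with lastMax-blocksAux p M (w ++ [ x ]) xs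
...   | (M≤L ∷ xs≤L) , L∈ = (M≤L ∷ ≤-trans (≮⇒≥ M≮x) M≤L ∷ xs≤L) , step L∈
  where
  step : ∀ {L} → L ∈ M ∷ xs → L ∈ M ∷ x ∷ xs
  step (here e) = here e
  step (there L∈xs) = there (there L∈xs)

ΦBlocks : ℕ → Blocks → List Step
ΦBlocks p [] = []
ΦBlocks p ((M , w) ∷ bs) = replicate (M ∸ p) U ++ replicate (suc (length w)) D ++ ΦBlocks M bs

ΦAux-block : ∀ p M w b bs →
  ΦAux p ((M , w) ∷ b ∷ bs) ≡ replicate (M ∸ p) U ++ replicate (suc (length w)) D ++ ΦAux M (b ∷ bs)
ΦAux-block p M [] b bs = refl
ΦAux-block p M (x ∷ w) b bs = refl

ΦAux-++ : ∀ p bs c cs → ΦAux p (bs ++ c ∷ cs) ≡ ΦBlocks p bs ++ ΦAux (lastMax p bs) (c ∷ cs)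
ΦAux-++ p [] c cs = refl
ΦAux-++ p ((M , w) ∷ bs) c cs = begin
  ΦAux p ((M , w) ∷ bs ++ c ∷ cs)                        ≡⟨ step bs ⟩
  ups ++ downs ++ ΦAux M (bs ++ c ∷ cs)                   ≡⟨ cong (λ t → ups ++ downs ++ t) (ΦAux-++ M bs c cs) ⟩
  ups ++ downs ++ ΦBlocks M bs ++ ΦAux (lastMax M bs) (c ∷ cs) ≡⟨ cong (ups ++_) (sym (++-assoc downs _ _)) ⟩
  ups ++ (downs ++ ΦBlocks M bs) ++ ΦAux (lastMax M bs) (c ∷ cs) ≡⟨ sym (++-assoc ups _ _) ⟩
  ΦBlocks p ((M , w) ∷ bs) ++ ΦAux (lastMax M bs) (c ∷ cs) ∎
  where
  open ≡-Reasoning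
  ups = replicate (M ∸ p) U
  downs = replicate (suc (length w)) D
  step : ∀ bs → ΦAux p ((M , w) ∷ bs ++ c ∷ cs) ≡ ups ++ downs ++ ΦAux M (bs ++ c ∷ cs)
  step [] = ΦAux-block p M w c cs
  step (b ∷ bs) = ΦAux-block p M w b (bs ++ c ∷ cs)

length-ΦBlocks : ∀ {p} bs → LRMaxima p bs → length (ΦBlocks p bs) + p ≡ lastMax p bs + length (flatten bs)
length-ΦBlocks {p} [] [] = sym (+-identityʳ p)
length-ΦBlocks {p} ((M , w) ∷ bs) (block p<M _ bs-ok) = begin
  length (ΦBlocks p ((M , w) ∷ bs)) + p
    ≡⟨ cong (_+ p) (length-block (M ∸ p) (suc (length w)) (ΦBlocks M bs)) ⟩
  (M ∸ p) + (suc (length w) + length (ΦBlocks M bs)) + p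
    ≡⟨ rearrange (M ∸ p) (length w) (length (ΦBlocks M bs)) p ⟩
  suc (length w) + (length (ΦBlocks M bs) + (M ∸ p + p))
    ≡⟨ cong (λ k → suc (length w) + (length (ΦBlocks M bs) + k)) (m∸n+n≡m (<⇒≤ p<M)) ⟩
  suc (length w) + (length (ΦBlocks M bs) + M)
    ≡⟨ cong (suc (length w) +_) (length-ΦBlocks bs bs-ok) ⟩
  suc (length w) + (lastMax M bs + length (flatten bs))
    ≡⟨ rearrange′ (length w) (lastMax M bs) (length (flatten bs)) ⟩
  lastMax M bs + suc (length w + length (flatten bs))
    ≡⟨ cong (λ k → lastMax M bs + suc k) (sym (length-++ w)) ⟩
  lastMax M bs + length (flatten ((M , w) ∷ bs))
    ∎
  where
  open ≡-Reasoning
  rearrange : ∀ a w F p → a + (suc w + F) + p ≡ suc w + (F + (a + p))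
  rearrange = solve-∀
  rearrange′ : ∀ w L f → suc w + (L + f) ≡ L + suc (w + f)
  rearrange′ = solve-∀

length-qs : ∀ x xs → length (qs (x ∷ xs)) ≡ length xs
length-qs x [] = refl
length-qs x (y ∷ ys) = cong suc (length-qs y ys)

∸-<⇔ : ∀ {l a b} → l ≤ a → (a ∸ l < b ∸ l ⇔ a < b)
∸-<⇔ {l} {a} {b} l≤a = mk⇔ cancel (λ a<b → ∸-monoˡ-< a<b l≤a)
  where
  cancel : a ∸ l < b ∸ l → a < b
  cancel lt with a <? b
  ... | yes a<b = a<b
  ... | no a≮b = ⊥-elim (<⇒≱ lt (∸-monoˡ-≤ l (≮⇒≥ a≮b)))

<ᵇ-∸ : ∀ {l} a b → l ≤ a → (a ∸ l <ᵇ b ∸ l) ≡ (a <ᵇ b)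
<ᵇ-∸ {l} a b l≤a = det
  (fromEquivalence (λ t → Equivalence.to (∸-<⇔ l≤a) (<ᵇ⇒< _ _ t)) (λ a<b → <⇒<ᵇ (Equivalence.from (∸-<⇔ l≤a) a<b)))
  (<ᵇ-reflects-< a b)

∸-∸-shift : ∀ {l p} M → l ≤ p → (M ∸ l) ∸ (p ∸ l) ≡ M ∸ p
∸-∸-shift {l} {p} M l≤p = trans (∸-+-assoc M l (p ∸ l)) (cong (M ∸_) (m+[n∸m]≡n l≤p))

shiftBlock : ℕ → ℕ × List ℕ → ℕ × List ℕ
shiftBlock l (M , w) = M ∸ l , map (_∸ l) w

-- The steps Q_j only depend on comparisons, hence are invariant under the shift.
allLt-shift : ∀ l x ys → All (l <_) ys → allLt (x ∸ l) (map (_∸ l) ys) ≡ allLt x ys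
allLt-shift l x [] _ = refl
allLt-shift l x (z ∷ zs) (l<z ∷ l<zs) rewrite <ᵇ-∸ z x (<⇒≤ l<z) | allLt-shift l x zs l<zs = refl

qs-shift : ∀ l xs → All (l <_) xs → qs (map (_∸ l) xs) ≡ qs xs
qs-shift l [] _ = refl
qs-shift l (x ∷ []) _ = refl
qs-shift l (x ∷ y ∷ ys) (_ ∷ l<ys) rewrite allLt-shift l x (y ∷ ys) l<ys | qs-shift l (y ∷ ys) l<ys = refl

blocksAux-shift : ∀ l M w ys → l < M → All (l <_) ys →
  blocksAux (M ∸ l) (map (_∸ l) w) (map (_∸ l) ys) ≡ map (shiftBlock l) (blocksAux M w ys)
blocksAux-shift l M w [] _ _ = refl
blocksAux-shift l M w (y ∷ ys) l<M (l<y ∷ l<ys) with M <? y | (M ∸ l) <? (y ∸ l)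
... | yes _ | yes _ = cong ((M ∸ l , map (_∸ l) w) ∷_) (blocksAux-shift l y [] ys l<y l<ys)
... | no _ | no _ = trans (cong (λ t → blocksAux (M ∸ l) t (map (_∸ l) ys)) (sym (map-++ (_∸ l) w [ y ])))
                          (blocksAux-shift l M (w ++ [ y ]) ys l<M l<ys)
... | yes M<y | no M≮y = ⊥-elim (M≮y (Equivalence.from (∸-<⇔ (<⇒≤ l<M)) M<y))
... | no M≮y | yes M<y = ⊥-elim (M≮y (Equivalence.to (∸-<⇔ (<⇒≤ l<M)) M<y))

ΦAux-shift : ∀ l p bs → l ≤ p → All (l <_) (flatten bs) → ΦAux (p ∸ l) (map (shiftBlock l) bs) ≡ ΦAux p bs
ΦAux-shift l p [] _ _ = refl
ΦAux-shift l p ((M , []) ∷ []) _ _ = refl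
ΦAux-shift l p ((M , x ∷ xs) ∷ []) l≤p (_ ∷ l<xs)
  rewrite ∸-∸-shift M l≤p | qs-shift l (x ∷ xs) (AllP.++⁻ˡ (x ∷ xs) l<xs) = refl
ΦAux-shift l p ((M , w) ∷ b ∷ bs) l≤p (l<M ∷ l<rest) = begin
  ΦAux (p ∸ l) (map (shiftBlock l) ((M , w) ∷ b ∷ bs))
    ≡⟨ ΦAux-block (p ∸ l) (M ∸ l) (map (_∸ l) w) (shiftBlock l b) (map (shiftBlock l) bs) ⟩
  replicate ((M ∸ l) ∸ (p ∸ l)) U ++ replicate (suc (length (map (_∸ l) w))) D ++ ΦAux (M ∸ l) (map (shiftBlock l) (b ∷ bs))
    ≡⟨ cong₂ (λ a t → replicate a U ++ replicate (suc t) D ++ ΦAux (M ∸ l) (map (shiftBlock l) (b ∷ bs))) (∸-∸-shift M l≤p) (length-map (_∸ l) w) ⟩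
  replicate (M ∸ p) U ++ replicate (suc (length w)) D ++ ΦAux (M ∸ l) (map (shiftBlock l) (b ∷ bs))
    ≡⟨ cong (λ t → replicate (M ∸ p) U ++ replicate (suc (length w)) D ++ t)
            (ΦAux-shift l M (b ∷ bs) (<⇒≤ l<M) (AllP.++⁻ʳ w l<rest)) ⟩
  replicate (M ∸ p) U ++ replicate (suc (length w)) D ++ ΦAux M (b ∷ bs)
    ≡⟨ sym (ΦAux-block p M w b bs) ⟩
  ΦAux p ((M , w) ∷ b ∷ bs) ∎
  where open ≡-Reasoning

filter-upTo : ∀ N x → x ≤ suc N → filter (_<? x) (applyUpTo suc N) ≡ applyUpTo suc (x ∸ 1)
filter-upTo zero zero _ = refl
filter-upTo zero (suc zero) _ = refl
filter-upTo zero (suc (suc x)) (s≤s ())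
filter-upTo (suc N) x x≤N+2 with x ≤? suc N
... | yes x≤N+1 = begin
  filter (_<? x) (applyUpTo suc (suc N))                  ≡⟨ cong (filter (_<? x)) (sym (applyUpTo-∷ʳ suc N)) ⟩
  filter (_<? x) (applyUpTo suc N ++ [ suc N ])           ≡⟨ filter-++ (_<? x) (applyUpTo suc N) [ suc N ] ⟩
  filter (_<? x) (applyUpTo suc N) ++ filter (_<? x) [ suc N ]
    ≡⟨ cong₂ _++_ (filter-upTo N x x≤N+1) (filter-none (_<? x) ((λ lt → <⇒≱ lt x≤N+1) ∷ [])) ⟩
  applyUpTo suc (x ∸ 1) ++ []                               ≡⟨ ++-identityʳ _ ⟩
  applyUpTo suc (x ∸ 1)                                     ∎
  where open ≡-Reasoning
... | no x≰N+1 with ≤-antisym x≤N+2 (≰⇒> x≰N+1)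
...   | refl = filter-all (_<? suc (suc N)) (AllP.applyUpTo⁺₁ suc (suc N) s≤s)

∈-upTo : ∀ {N z} → z ∈ applyUpTo suc N → 0 < z × z ≤ N
∈-upTo z∈ with ∈-applyUpTo⁻ suc z∈
... | _ , i<N , refl = s≤s z≤n , i<N

perm-length : ∀ {N σ} → IsPerm N σ → length σ ≡ N
perm-length {N} perm = trans (↭-length perm) (length-applyUpTo suc N)

perm-entry : ∀ {N σ z} → IsPerm N σ → z ∈ σ → 0 < z × z ≤ N
perm-entry perm z∈ = ∈-upTo (∈-resp-↭ perm z∈)

perm-bounded : ∀ {N σ} → IsPerm N σ → All (_≤ N) σ
perm-bounded perm = tabulate (λ z∈ → proj₂ (perm-entry perm z∈))

perm-∋-max : ∀ {N σ} → IsPerm (suc N) σ → suc N ∈ σ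
perm-∋-max {N} perm = ∈-resp-↭ (↭-sym perm) (∈-applyUpTo⁺ suc {N} ≤-refl)

filter-++-below : ∀ x π ρ → All (_< x) π → filter (_<? x) (π ++ ρ) ≡ π ++ filter (_<? x) ρ
filter-++-below x π ρ π<x = trans (filter-++ (_<? x) π ρ) (cong (_++ filter (_<? x) ρ) (filter-all (_<? x) π<x))

length-++-below : ∀ x π ρ → All (_< x) π → length (filter (_<? x) (π ++ ρ)) ≡ length π + length (filter (_<? x) ρ)
length-++-below x π ρ π<x = trans (cong length (filter-++-below x π ρ π<x)) (length-++ π)

module _ {N : ℕ} {σ : List ℕ} (perm : IsPerm N σ) where

  filter-perm : ∀ x → x ≤ suc N → filter (_<? x) σ ↭ applyUpTo suc (x ∸ 1)
  filter-perm x x≤N+1 = subst (filter (_<? x) σ ↭_) (filter-upTo N x x≤N+1) (filter-↭ (_<? x) perm)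

  count-below : ∀ x → x ≤ suc N → length (filter (_<? x) σ) ≡ x ∸ 1
  count-below x x≤N+1 = perm-length (filter-perm x x≤N+1)

  prefix-length : ∀ π ρ → σ ≡ π ++ ρ → length π ≤ N
  prefix-length π ρ eq = begin
    length π              ≤⟨ m≤m+n (length π) (length ρ) ⟩
    length π + length ρ   ≡⟨ sym (length-++ π) ⟩
    length (π ++ ρ)       ≡⟨ cong length (sym eq) ⟩
    length σ              ≡⟨ perm-length perm ⟩
    N                     ∎
    where open ≤-Reasoning

  prefix-bounded : ∀ π ρ m → σ ≡ π ++ ρ → All (_≤ m) π → length π ≤ m
  prefix-bounded π ρ m eq π≤m with m ≤? N
  ... | no m≰N = ≤-trans (prefix-length π ρ eq) (<⇒≤ (≰⇒> m≰N))
  ... | yes m≤N = begin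
    length π                                    ≤⟨ m≤m+n (length π) _ ⟩
    length π + length (filter (_<? suc m) ρ)     ≡⟨ sym (length-++-below (suc m) π ρ (All.map s≤s π≤m)) ⟩
    length (filter (_<? suc m) (π ++ ρ))         ≡⟨ cong (λ s → length (filter (_<? suc m) s)) (sym eq) ⟩
    length (filter (_<? suc m) σ)                ≡⟨ count-below (suc m) (s≤s m≤N) ⟩
    m                                           ∎
    where open ≤-Reasoning

  prefix-perm : ∀ π ρ m → σ ≡ π ++ ρ → All (_≤ m) π → length π ≡ m → IsPerm m π
  prefix-perm π ρ m eq π≤m |π|≡m = subst (_↭ applyUpTo suc m) filter-σ≡π (filter-perm (suc m) (s≤s m≤N))
    where
    m≤N : m ≤ N
    m≤N = subst (_≤ N) |π|≡m (prefix-length π ρ eq)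
    filter-σ : filter (_<? suc m) σ ≡ π ++ filter (_<? suc m) ρ
    filter-σ = trans (cong (filter (_<? suc m)) eq) (filter-++-below (suc m) π ρ (All.map s≤s π≤m))
    no-rest : length (filter (_<? suc m) ρ) ≡ 0
    no-rest = +-cancelˡ-≡ m _ _ (begin
      m + length (filter (_<? suc m) ρ)       ≡⟨ cong (_+ _) (sym |π|≡m) ⟩
      length π + length (filter (_<? suc m) ρ) ≡⟨ sym (length-++ π) ⟩
      length (π ++ filter (_<? suc m) ρ)      ≡⟨ cong length (sym filter-σ) ⟩
      length (filter (_<? suc m) σ)           ≡⟨ count-below (suc m) (s≤s m≤N) ⟩
      m                                       ≡⟨ sym (+-identityʳ m) ⟩
      m + 0                                   ∎)
      where open ≡-Reasoning
    empty : ∀ (xs : List ℕ) → length xs ≡ 0 → xs ≡ []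
    empty [] _ = refl
    filter-σ≡π : filter (_<? suc m) σ ≡ π
    filter-σ≡π = trans filter-σ (trans (cong (π ++_) (empty _ no-rest)) (++-identityʳ π))

  suffix-above : ∀ σ′ σ″ l → σ ≡ σ′ ++ σ″ → IsPerm l σ′ → All (l <_) σ″
  suffix-above σ′ σ″ l eq perm′ = tabulate above
    where
    l≤N : l ≤ N
    l≤N = subst (_≤ N) (perm-length perm′) (prefix-length σ′ σ″ eq)
    count : length σ′ + length (filter (_<? suc l) σ″) ≡ l
    count = trans (sym (length-++-below (suc l) σ′ σ″ (All.map s≤s (perm-bounded perm′))))
                  (trans (cong (λ s → length (filter (_<? suc l) s)) (sym eq)) (count-below (suc l) (s≤s l≤N)))
    above : ∀ {z} → z ∈ σ″ → l < z
    above {z} z∈ with l <? z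
    ... | yes l<z = l<z
    ... | no l≮z = ⊥-elim (<-irrefl refl (begin-strict
      l                                         <⟨ n<1+n l ⟩
      suc l                                     ≡⟨ +-comm 1 l ⟩
      l + 1
        ≤⟨ +-monoʳ-≤ l (filter-some (_<? suc l) (Any.map (λ { refl → s≤s (≮⇒≥ l≮z) }) z∈)) ⟩
      l + length (filter (_<? suc l) σ″)         ≡⟨ cong (_+ _) (sym (perm-length perm′)) ⟩
      length σ′ + length (filter (_<? suc l) σ″) ≡⟨ count ⟩
      l                                         ∎))
      where open ≤-Reasoning

  renorm-suffix : ∀ σ′ σ″ l → σ ≡ σ′ ++ σ″ → IsPerm l σ′ → renorm σ″ ≡ map (_∸ l) σ″
  renorm-suffix σ′ σ″ l eq perm′ = map-cong-local (tabulate rank)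
    where
    rank : ∀ {x} → x ∈ σ″ → suc (length (filter (_<? x) σ″)) ≡ x ∸ l
    rank {x} x∈ with perm-entry perm (subst (x ∈_) (sym eq) (∈-++⁺ʳ σ′ x∈)) | All.lookup (suffix-above σ′ σ″ l eq perm′) x∈
    ... | s≤s z≤n , x≤N | s≤s l≤x-1 = begin
      suc F                  ≡⟨ cong suc (sym (m+n∸m≡n l F)) ⟩
      suc ((l + F) ∸ l)      ≡⟨ cong (λ k → suc (k ∸ l)) l+F≡x-1 ⟩
      suc (x ∸ 1 ∸ l)        ≡⟨ sym (+-∸-assoc 1 l≤x-1) ⟩
      x ∸ l                  ∎
      where
      open ≡-Reasoning
      F = length (filter (_<? x) σ″)
      l+F≡x-1 : l + F ≡ x ∸ 1
      l+F≡x-1 = begin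
        l + F                                 ≡⟨ cong (_+ F) (sym (perm-length perm′)) ⟩
        length σ′ + F
          ≡⟨ sym (length-++-below x σ′ σ″ (All.map (λ z≤l → s≤s (≤-trans z≤l l≤x-1)) (perm-bounded perm′))) ⟩
        length (filter (_<? x) (σ′ ++ σ″))     ≡⟨ cong (λ s → length (filter (_<? x) s)) (sym eq) ⟩
        length (filter (_<? x) σ)              ≡⟨ count-below x (≤-trans x≤N (n≤1+n N)) ⟩
        x ∸ 1                                 ∎

block-heights : ∀ {p M} π w → length π ≤ p → p < M → length (π ++ M ∷ w) ≤ M →
  suc (length w) ≤ (p ∸ length π) + (M ∸ p) ×
  (p ∸ length π) + (M ∸ p) ∸ suc (length w) ≡ M ∸ length (π ++ M ∷ w)
block-heights {p} {M} π w π≤p p<M πMw≤M =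
  subst (λ h → suc (length w) ≤ h × h ∸ suc (length w) ≡ M ∸ length (π ++ M ∷ w)) (sym climb) (descent≤ , descent≡)
  where
  climb : (p ∸ length π) + (M ∸ p) ≡ M ∸ length π
  climb = begin
    (p ∸ length π) + (M ∸ p)   ≡⟨ +-comm (p ∸ length π) (M ∸ p) ⟩
    (M ∸ p) + (p ∸ length π)   ≡⟨ sym (+-∸-assoc (M ∸ p) π≤p) ⟩
    (M ∸ p + p) ∸ length π     ≡⟨ cong (_∸ length π) (m∸n+n≡m (<⇒≤ p<M)) ⟩
    M ∸ length π               ∎
    where open ≡-Reasoning
  πMw≤M′ : length π + suc (length w) ≤ M
  πMw≤M′ = subst (_≤ M) (length-++ π) πMw≤M
  descent≤ : suc (length w) ≤ M ∸ length π
  descent≤ = subst (_≤ M ∸ length π) (m+n∸m≡n (length π) (suc (length w))) (∸-monoˡ-≤ (length π) πMw≤M′)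
  descent≡ : M ∸ length π ∸ suc (length w) ≡ M ∸ length (π ++ M ∷ w)
  descent≡ = trans (∸-+-assoc M (length π) (suc (length w))) (cong (M ∸_) (sym (length-++ π)))

blocks-LRMaxima : ∀ {N σ} → IsPerm N σ → LRMaxima 0 (blocks σ)
blocks-LRMaxima {σ = []} _ = []
blocks-LRMaxima {σ = x ∷ xs} perm = blocksAux-LRMaxima x [] xs (proj₁ (perm-entry perm (here refl))) []

-- Heights of Φ σ along a permutation σ of {1,…,N}.  A "state" is the prefix
-- π read so far together with its maximum p; the path is then at height
-- p ∸ |π|, and pigeonhole keeps |π| ≤ p.
module _ {N : ℕ} {σ : List ℕ} (perm : IsPerm N σ) where

  next-state : ∀ {p M} π w ρ → σ ≡ π ++ M ∷ w ++ ρ → All (_≤ p) π → p < M → All (_≤ M) w →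
    σ ≡ (π ++ M ∷ w) ++ ρ × All (_≤ M) (π ++ M ∷ w) × length (π ++ M ∷ w) ≤ M
  next-state π w ρ eq π≤p p<M w≤M = eq′ , πMw≤M , prefix-bounded perm (π ++ _ ∷ w) ρ _ eq′ πMw≤M
    where
    eq′ = trans eq (sym (++-assoc π _ ρ))
    πMw≤M = AllP.++⁺ (All.map (λ z≤p → ≤-trans z≤p (<⇒≤ p<M)) π≤p) (≤-refl ∷ w≤M)

  -- The last block x₁ ⋯ x_l is too short to bring the path back to the axis.
  last-block-short : ∀ {p M} π x xs → σ ≡ π ++ M ∷ (x ∷ xs) ++ [] → All (_≤ p) π → length π ≤ p → p < M →
    All (_≤ M) (x ∷ xs) → length (qs (x ∷ xs)) < (p ∸ length π) + (M ∸ p)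
  last-block-short {p} {M} π x xs eq π≤p |π|≤p p<M w≤M with next-state π (x ∷ xs) [] eq π≤p p<M w≤M
  ... | _ , _ , πMw≤M = begin-strict
    length (qs (x ∷ xs))                 ≡⟨ length-qs x xs ⟩
    length xs                            ≤⟨ n≤1+n (length xs) ⟩
    suc (length xs)                      <⟨ proj₁ (block-heights π (x ∷ xs) |π|≤p p<M πMw≤M) ⟩
    (p ∸ length π) + (M ∸ p)             ∎
    where open ≤-Reasoning

  ΦAux-prefix : ∀ {p} π bs → LRMaxima p bs → σ ≡ π ++ flatten bs → All (_≤ p) π → length π ≤ p →
    PrefixFrom (p ∸ length π) (ΦAux p bs)
  ΦAux-prefix π [] _ _ _ _ = []
  ΦAux-prefix π ((M , []) ∷ []) _ _ _ _ = []
  ΦAux-prefix {p} π ((M , x ∷ xs) ∷ []) (block p<M w≤M []) eq π≤p |π|≤p =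
    prefix-ups (M ∸ p) (prefix-short (qs (x ∷ xs)) (<⇒≤ (last-block-short π x xs eq π≤p |π|≤p p<M w≤M)))
  ΦAux-prefix {p} π ((M , w) ∷ b ∷ bs) (block p<M w≤M bs-ok) eq π≤p |π|≤p
    with next-state π w (flatten (b ∷ bs)) eq π≤p p<M w≤M
  ... | eq′ , πMw≤M , |πMw|≤M with block-heights π w |π|≤p p<M |πMw|≤M
  ... | d≤h , h′≡ = subst (PrefixFrom (p ∸ length π)) (sym (ΦAux-block p M w b bs))
    (prefix-ups (M ∸ p) (prefix-downs (suc (length w)) d≤h
      (subst (λ h → PrefixFrom h (ΦAux M (b ∷ bs))) (sym h′≡)
        (ΦAux-prefix (π ++ M ∷ w) (b ∷ bs) bs-ok eq′ πMw≤M |πMw|≤M))))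

  ΦBlocks-path : ∀ {p} π bs ρ → LRMaxima p bs → σ ≡ π ++ flatten bs ++ ρ → All (_≤ p) π → length π ≤ p →
    lastMax p bs ≡ length π + length (flatten bs) → PathFrom (p ∸ length π) (ΦBlocks p bs)
  ΦBlocks-path π [] _ _ _ _ _ last≡ =
    subst (λ h → PathFrom h []) (sym (m≤n⇒m∸n≡0 (≤-reflexive (trans last≡ (+-identityʳ _))))) []
  ΦBlocks-path {p} π ((M , w) ∷ bs) ρ (block p<M w≤M bs-ok) eq π≤p |π|≤p last≡
    with next-state π w (flatten bs ++ ρ) (trans eq (cong (λ t → π ++ M ∷ t) (++-assoc w (flatten bs) ρ))) π≤p p<M w≤M
  ... | eq′ , πMw≤M , |πMw|≤M with block-heights π w |π|≤p p<M |πMw|≤M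
  ... | d≤h , h′≡ = path-ups (M ∸ p) (path-downs (suc (length w)) d≤h
        (subst (λ h → PathFrom h (ΦBlocks M bs)) (sym h′≡)
          (ΦBlocks-path (π ++ M ∷ w) bs ρ bs-ok eq′ πMw≤M |πMw|≤M last≡′)))
    where
    open ≡-Reasoning
    last≡′ : lastMax M bs ≡ length (π ++ M ∷ w) + length (flatten bs)
    last≡′ = begin
      lastMax M bs                                          ≡⟨ last≡ ⟩
      length π + length ((M ∷ w) ++ flatten bs)             ≡⟨ cong (length π +_) (length-++ (M ∷ w)) ⟩
      length π + (length (M ∷ w) + length (flatten bs))     ≡⟨ sym (+-assoc (length π) _ _) ⟩
      length π + length (M ∷ w) + length (flatten bs)       ≡⟨ cong (_+ length (flatten bs)) (sym (length-++ π)) ⟩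
      length (π ++ M ∷ w) + length (flatten bs)             ∎

  -- Reading Φ from state (π, p), a returning path P′ ends at a state π′
  -- that permutes {1,…,|π′|} with part of σ still unread; P′ has length
  -- 2|π′| − p − |π|.
  ReturnsAt : ℕ → List ℕ → List Step → Set
  ReturnsAt p π P′ = ∃[ π′ ] ∃[ ρ ] (σ ≡ π′ ++ ρ × IsPerm (length π′) π′ × ρ ≢ [] ×
                       length π′ + length π′ ≡ p + length π + length P′)

  -- The path is on the axis, so the state itself is such a point.
  returns-here : ∀ {p} π ρ → σ ≡ π ++ ρ → ρ ≢ [] → All (_≤ p) π → length π ≤ p → p ∸ length π ≡ 0 →
    ReturnsAt p π []
  returns-here π ρ eq ρ≢[] π≤p |π|≤p h≡0 with ≤-antisym (m∸n≡0⇒m≤n h≡0) |π|≤p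
  ... | refl = π , ρ , eq , prefix-perm perm π ρ (length π) eq π≤p refl , ρ≢[] , sym (+-identityʳ _)

  -- Returns to the axis only happen at the end of a complete block: never
  -- inside a climb, a descent, or the last block.
  returns-at-boundary : ∀ {p} π M w rest → LRMaxima p ((M , w) ∷ rest) → σ ≡ π ++ M ∷ w ++ flatten rest →
    All (_≤ p) π → length π ≤ p → ∀ {P′ P″} → ΦAux p ((M , w) ∷ rest) ≡ P′ ++ P″ →
    PathFrom (p ∸ length π) P′ → ReturnsAt p π P′
  returns-at-boundary π M [] [] _ eq π≤p |π|≤p {[]} _ P′-path =
    returns-here π _ eq (λ ()) π≤p |π|≤p (path-at-axis P′-path)
  returns-at-boundary π M [] [] _ _ _ _ {_ ∷ _} () _
  returns-at-boundary {p} π M (x ∷ xs) [] (block p<M w≤M []) eq π≤p |π|≤p e P′-path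
    with path-before-ups (M ∸ p) (qs (x ∷ xs)) P′-path (sym e) (last-block-short π x xs eq π≤p |π|≤p p<M w≤M)
  ... | refl , h≡0 = returns-here π _ eq (λ ()) π≤p |π|≤p h≡0
  returns-at-boundary {p} π M w ((M′ , w′) ∷ rest) (block p<M w≤M rest-ok) eq π≤p |π|≤p e P′-path
    with path-across-ups (M ∸ p) P′-path (trans (sym e) (ΦAux-block p M w (M′ , w′) rest))
  ... | inj₁ (refl , h≡0) = returns-here π _ eq (λ ()) π≤p |π|≤p h≡0
  ... | inj₂ (P₀ , refl , P₀-path , e₀) with next-state π w (flatten ((M′ , w′) ∷ rest)) eq π≤p p<M w≤M
  ... | eq′ , πMw≤M , |πMw|≤M with block-heights π w |π|≤p p<M |πMw|≤M
  ... | d≤h , h′≡ with path-across-downs (suc (length w)) d≤h P₀-path e₀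
  ... | P₁ , refl , P₁-path , e₁
    with returns-at-boundary (π ++ M ∷ w) M′ w′ rest rest-ok eq′ πMw≤M |πMw|≤M (sym e₁)
           (subst (λ h → PathFrom h P₁) h′≡ P₁-path)
  ... | π′ , ρ , eqπ′ , perm′ , ρ≢[] , count = π′ , ρ , eqπ′ , perm′ , ρ≢[] , trans count count-step
    where
    open ≡-Reasoning
    rearrange : ∀ a p c d f → a + p + (c + d) + f ≡ p + c + (a + (d + f))
    rearrange = solve-∀
    count-step : M + length (π ++ M ∷ w) + length P₁ ≡
                 p + length π + length (replicate (M ∸ p) U ++ replicate (suc (length w)) D ++ P₁)
    count-step = begin
      M + length (π ++ M ∷ w) + length P₁
        ≡⟨ cong₂ (λ m k → m + k + length P₁) (sym (m∸n+n≡m (<⇒≤ p<M))) (length-++ π) ⟩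
      (M ∸ p) + p + (length π + suc (length w)) + length P₁
        ≡⟨ rearrange (M ∸ p) p (length π) (suc (length w)) (length P₁) ⟩
      p + length π + ((M ∸ p) + (suc (length w) + length P₁))
        ≡⟨ cong (p + length π +_) (sym (length-block (M ∸ p) (suc (length w)) P₁)) ⟩
      p + length π + length (replicate (M ∸ p) U ++ replicate (suc (length w)) D ++ P₁) ∎

lastMax-perm : ∀ {l σ′} → IsPerm l σ′ → lastMax 0 (blocks σ′) ≡ l
lastMax-perm {zero} {[]} _ = refl
lastMax-perm {zero} {_ ∷ _} perm′ with perm-length perm′
... | ()
lastMax-perm {suc l} {[]} perm′ with perm-length perm′
... | ()
lastMax-perm {suc l} {x ∷ xs} perm′ with lastMax-blocksAux 0 x [] xs
... | below-L , L∈ = ≤-antisym (All.lookup (perm-bounded perm′) L∈) (All.lookup below-L (perm-∋-max perm′))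

Φ-++ : ∀ π y ys → All (_< y) π →
  Φ (π ++ y ∷ ys) ≡ ΦBlocks 0 (blocks π) ++ ΦAux (lastMax 0 (blocks π)) (blocksAux y [] ys)
Φ-++ π y ys π<y with blocksAux-nonempty y [] ys
... | c , cs , e = begin
  ΦAux 0 (blocks (π ++ y ∷ ys))                      ≡⟨ cong (ΦAux 0) (blocks-++ π y ys π<y) ⟩
  ΦAux 0 (blocks π ++ blocksAux y [] ys)             ≡⟨ cong (λ bs → ΦAux 0 (blocks π ++ bs)) e ⟩
  ΦAux 0 (blocks π ++ c ∷ cs)                        ≡⟨ ΦAux-++ 0 (blocks π) c cs ⟩
  ΦBlocks 0 (blocks π) ++ ΦAux L (c ∷ cs)            ≡⟨ cong (λ bs → ΦBlocks 0 (blocks π) ++ ΦAux L bs) (sym e) ⟩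
  ΦBlocks 0 (blocks π) ++ ΦAux L (blocksAux y [] ys) ∎
  where
  open ≡-Reasoning
  L = lastMax 0 (blocks π)

Φ-shift : ∀ l y ys → All (l <_) (y ∷ ys) → Φ (map (_∸ l) (y ∷ ys)) ≡ ΦAux l (blocksAux y [] ys)
Φ-shift l y ys (l<y ∷ l<ys) = begin
  ΦAux 0 (blocksAux (y ∸ l) [] (map (_∸ l) ys))        ≡⟨ cong (ΦAux 0) (blocksAux-shift l y [] ys l<y l<ys) ⟩
  ΦAux 0 (map (shiftBlock l) (blocksAux y [] ys))
    ≡⟨ cong (λ p → ΦAux p (map (shiftBlock l) (blocksAux y [] ys))) (sym (n∸n≡0 l)) ⟩
  ΦAux (l ∸ l) (map (shiftBlock l) (blocksAux y [] ys)) ≡⟨ ΦAux-shift l l (blocksAux y [] ys) ≤-refl l<entries ⟩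
  ΦAux l (blocksAux y [] ys)                           ∎
  where
  open ≡-Reasoning
  l<entries : All (l <_) (flatten (blocksAux y [] ys))
  l<entries = subst (All (l <_)) (sym (flatten-blocksAux y [] ys)) (l<y ∷ l<ys)

Φ-append-max : ∀ {l σ′} → IsPerm l σ′ → Φ (σ′ ++ [ suc l ]) ≡ ΦBlocks 0 (blocks σ′)
Φ-append-max {l} {σ′} perm′ =
  trans (Φ-++ σ′ (suc l) [] (All.map s≤s (perm-bounded perm′))) (++-identityʳ (ΦBlocks 0 (blocks σ′)))

ΦBlocks-perm : ∀ {l σ′} → IsPerm l σ′ → DyckPath (ΦBlocks 0 (blocks σ′)) × length (ΦBlocks 0 (blocks σ′)) ≡ 2 * l
ΦBlocks-perm {l} {σ′} perm′ =
  ΦBlocks-path perm′ [] (blocks σ′) [] (blocks-LRMaxima perm′) σ′≡ [] z≤n last≡ , length≡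
  where
  open ≡-Reasoning
  σ′≡ : σ′ ≡ flatten (blocks σ′) ++ []
  σ′≡ = sym (trans (++-identityʳ _) (flatten-blocks σ′))
  |flatten|≡l : length (flatten (blocks σ′)) ≡ l
  |flatten|≡l = trans (cong length (flatten-blocks σ′)) (perm-length perm′)
  last≡ : lastMax 0 (blocks σ′) ≡ length (flatten (blocks σ′))
  last≡ = trans (lastMax-perm perm′) (sym |flatten|≡l)
  length≡ : length (ΦBlocks 0 (blocks σ′)) ≡ 2 * l
  length≡ = begin
    length (ΦBlocks 0 (blocks σ′))                              ≡⟨ sym (+-identityʳ _) ⟩
    length (ΦBlocks 0 (blocks σ′)) + 0
      ≡⟨ length-ΦBlocks (blocks σ′) (blocks-LRMaxima perm′) ⟩
    lastMax 0 (blocks σ′) + length (flatten (blocks σ′))        ≡⟨ cong₂ _+_ (lastMax-perm perm′) |flatten|≡l ⟩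
    l + l                                                       ≡⟨ cong (l +_) (sym (+-identityʳ l)) ⟩
    2 * l                                                       ∎

Φ-split : ∀ {N σ l σ′ y ys} → IsPerm N σ → σ ≡ σ′ ++ y ∷ ys → IsPerm l σ′ →
  Φ σ ≡ Φ (σ′ ++ [ suc l ]) ++ Φ (renorm (y ∷ ys))
Φ-split {σ = σ} {l} {σ′} {y} {ys} perm eq perm′ = begin
  Φ σ                                                         ≡⟨ cong Φ eq ⟩
  Φ (σ′ ++ y ∷ ys)                                            ≡⟨ Φ-++ σ′ y ys σ′<y ⟩
  ΦBlocks 0 (blocks σ′) ++ ΦAux (lastMax 0 (blocks σ′)) (blocksAux y [] ys)
    ≡⟨ cong₂ (λ P L → P ++ ΦAux L (blocksAux y [] ys)) (sym (Φ-append-max perm′)) (lastMax-perm perm′) ⟩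
  Φ (σ′ ++ [ suc l ]) ++ ΦAux l (blocksAux y [] ys)
    ≡⟨ cong (Φ (σ′ ++ [ suc l ]) ++_) (sym (Φ-shift l y ys above)) ⟩
  Φ (σ′ ++ [ suc l ]) ++ Φ (map (_∸ l) (y ∷ ys))
    ≡⟨ cong (λ ρ → Φ (σ′ ++ [ suc l ]) ++ Φ ρ) (sym (renorm-suffix perm σ′ (y ∷ ys) l eq perm′)) ⟩
  Φ (σ′ ++ [ suc l ]) ++ Φ (renorm (y ∷ ys))                  ∎
  where
  open ≡-Reasoning
  above : All (l <_) (y ∷ ys)
  above = suffix-above perm σ′ (y ∷ ys) l eq perm′
  σ′<y : All (_< y) σ′
  σ′<y = All.map (λ z≤l → ≤-<-trans z≤l (All.head above)) (perm-bounded perm′)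

Φ-prefix : ∀ {N σ} → IsPerm N σ → DyckPrefix (Φ σ)
Φ-prefix {σ = σ} perm = ΦAux-prefix perm [] (blocks σ) (blocks-LRMaxima perm) (sym (flatten-blocks σ)) [] z≤n

double-injective : ∀ m l → m + m ≡ 2 * l → m ≡ l
double-injective m l e = *-cancelˡ-≡ m l 2 (trans (cong (m +_) (+-identityʳ m)) e)

Φ-return : ∀ {N σ P′ P″ l} → IsPerm (suc N) σ → Φ σ ≡ P′ ++ P″ → DyckPath P′ → length P′ ≡ 2 * l →
  ∃[ σ′ ] ∃[ σ″ ] (σ ≡ σ′ ++ σ″ × IsPerm l σ′ × σ″ ≢ [])
Φ-return {σ = []} perm _ _ _ with perm-length perm
... | ()
Φ-return {σ = x ∷ xs} {l = l} perm eΦ P′-path |P′|≡2l with blocksAux-nonempty x [] xs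
... | (M , w) , rest , e
  with returns-at-boundary perm [] M w rest (subst (LRMaxima 0) e (blocks-LRMaxima perm))
         (sym (trans (cong flatten (sym e)) (flatten-blocks (x ∷ xs)))) [] z≤n
         (trans (cong (ΦAux 0) (sym e)) eΦ) P′-path
... | σ′ , σ″ , eq , perm′ , σ″≢[] , count =
  σ′ , σ″ , eq , subst (λ m → IsPerm m σ′) (double-injective (length σ′) l (trans count |P′|≡2l)) perm′ , σ″≢[]

cap : ℕ → ℕ → ℕ → ℕ
cap l y z with z ≤? l
... | yes _ = z
... | no _ = y

cap-low : ∀ l y z → z ≤ l → cap l y z ≡ z
cap-low l y z z≤l with z ≤? l
... | yes _ = refl
... | no z≰l = ⊥-elim (z≰l z≤l)

cap-top : ∀ l y → cap l y (suc l) ≡ y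
cap-top l y with suc l ≤? l
... | yes l+1≤l = ⊥-elim (<-irrefl refl l+1≤l)
... | no _ = refl

cap-<⇔ : ∀ {l y a b} → l < y → a ≤ suc l → b ≤ suc l → (a < b ⇔ cap l y a < cap l y b)
cap-<⇔ {l} {y} {a} {b} l<y a≤ b≤ with a ≤? l | b ≤? l
... | yes _ | yes _ = mk⇔ (λ a<b → a<b) (λ a<b → a<b)
... | yes a≤l | no b≰l = mk⇔ (λ _ → ≤-<-trans a≤l l<y) (λ _ → ≤-<-trans a≤l (≰⇒> b≰l))
... | no a≰l | yes b≤l =
  mk⇔ (λ a<b → ⊥-elim (a≰l (≤-trans (<⇒≤ a<b) b≤l))) (λ y<b → ⊥-elim (<⇒≱ l<y (≤-trans (<⇒≤ y<b) b≤l)))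
... | no a≰l | no _ =
  mk⇔ (λ a<b → ⊥-elim (<⇒≱ a<b (≤-trans b≤ (≰⇒> a≰l)))) (λ y<y → ⊥-elim (<-irrefl refl y<y))

contains-⊆ : ∀ {xs ys τ} → xs ⊆ ys → Contains xs τ → Contains ys τ
contains-⊆ xs⊆ys (zs , zs⊆xs , iso) = zs , ⊆-trans zs⊆xs xs⊆ys , iso

module _ (P : ℕ → Set) (f : ℕ → ℕ) (mono : ∀ {a b} → P a → P b → (a < b ⇔ f a < f b)) where

  ordIso-map : ∀ {zs τ} → All P zs → OrdIso zs τ → OrdIso (map f zs) τ
  ordIso-map [] [] = []
  ordIso-map (Px ∷ Pzs) (rel ∷ iso) = compare Px Pzs rel ∷ ordIso-map Pzs iso
    where
    compare : ∀ {x t xs ts} → P x → All P xs →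
      Pointwise (λ a b → (x < a ⇔ t < b)) xs ts → Pointwise (λ a b → (f x < a ⇔ t < b)) (map f xs) ts
    compare Px [] [] = []
    compare Px (Pa ∷ Pas) (r ∷ rs) = (r ⇔-∘ ⇔-sym (mono Px Pa)) ∷ compare Px Pas rs

  contains-map : ∀ {xs τ} → All P xs → Contains xs τ → Contains (map f xs) τ
  contains-map Pxs (zs , zs⊆xs , iso) = map f zs , map⁺ f zs⊆xs , ordIso-map (All-resp-⊆ zs⊆xs Pxs) iso

-- σ′ (l+1) has the same relative order as the subword σ′ y of σ = σ′ y ys,
-- so it avoids every pattern σ avoids.
append-max-avoids : ∀ {σ σ′ y ys l} T → σ ≡ σ′ ++ y ∷ ys → All (_≤ l) σ′ → l < y →
  Avoids σ T → Avoids (σ′ ++ [ suc l ]) T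
append-max-avoids {σ} {σ′} {y} {ys} {l} T eq σ′≤l l<y = All.map (λ σ-avoids τ-contains → σ-avoids (in-σ τ-contains))
  where
  τ≤l+1 : All (_≤ suc l) (σ′ ++ [ suc l ])
  τ≤l+1 = AllP.++⁺ (All.map (λ z≤l → ≤-trans z≤l (n≤1+n l)) σ′≤l) (≤-refl ∷ [])
  cap-τ : map (cap l y) (σ′ ++ [ suc l ]) ≡ σ′ ++ [ y ]
  cap-τ = trans (map-++ (cap l y) σ′ [ suc l ])
    (cong₂ _++_ (map-id-local (All.map (cap-low l y _) σ′≤l)) (cong [_] (cap-top l y)))
  σ′y⊆σ : σ′ ++ [ y ] ⊆ σ
  σ′y⊆σ = subst (σ′ ++ [ y ] ⊆_) (sym eq) (++⁺ ⊆-refl (refl ∷ []⊆-universal ys))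
  in-σ : ∀ {τ} → Contains (σ′ ++ [ suc l ]) τ → Contains σ τ
  in-σ c = contains-⊆ σ′y⊆σ (subst (λ w → Contains w _) cap-τ (contains-map (_≤ suc l) (cap l y) (cap-<⇔ l<y) τ≤l+1 c))

append-max-class : ∀ {N σ l σ′ y ys} → InAvT₁∪T₂ N σ → σ ≡ σ′ ++ y ∷ ys → IsPerm l σ′ →
  InAvT₁∪T₂ (suc l) (σ′ ++ [ suc l ])
append-max-class {l = l} {σ′} {y} {ys} (perm , avoids) eq perm′ =
  subst (σ′ ++ [ suc l ] ↭_) (applyUpTo-∷ʳ suc l) (++⁺ʳ [ suc l ] perm′) ,
  Sum.map (append-max-avoids T₁ eq σ′≤l l<y) (append-max-avoids T₂ eq σ′≤l l<y) avoids
  where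
  σ′≤l = perm-bounded perm′
  l<y = All.head (suffix-above perm σ′ (y ∷ ys) l eq perm′)

decomposition : ∀ {N σ l σ′ σ″} → IsPerm N σ → σ ≡ σ′ ++ σ″ → IsPerm l σ′ → σ″ ≢ [] →
  Φ σ ≡ Φ (σ′ ++ [ suc l ]) ++ Φ (renorm σ″) × DyckPath (Φ (σ′ ++ [ suc l ])) ×
  length (Φ (σ′ ++ [ suc l ])) ≡ 2 * l × DyckPrefix (Φ (renorm σ″))
decomposition {σ″ = []} _ _ _ σ″≢[] = ⊥-elim (σ″≢[] refl)
decomposition {σ″ = y ∷ ys} perm eq perm′ _ =
  split , path , trans (cong length (Φ-append-max perm′)) (proj₂ (ΦBlocks-perm perm′)) ,
  prefix-after-path _ path (subst DyckPrefix split (Φ-prefix perm))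
  where
  split = Φ-split perm eq perm′
  path = subst DyckPath (sym (Φ-append-max perm′)) (proj₁ (ΦBlocks-perm perm′))

++-split-unique : ∀ {A : Set} (xs ys us vs : List A) → xs ++ ys ≡ us ++ vs → length xs ≡ length us →
  xs ≡ us × ys ≡ vs
++-split-unique [] ys [] vs eq _ = refl , eq
++-split-unique (x ∷ xs) ys (u ∷ us) vs eq |xs|≡|us| with ∷-injective eq
... | refl , eq′ with ++-split-unique xs ys us vs eq′ (suc-injective |xs|≡|us|)
...   | refl , ys≡vs = refl , ys≡vs

identification : ∀ {N σ l P′ P″ σ′ σ″} → InAvT₁∪T₂ N σ → Φ σ ≡ P′ ++ P″ → length P′ ≡ 2 * l →
  σ ≡ σ′ ++ σ″ → IsPerm l σ′ → σ″ ≢ [] →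
  InAvT₁∪T₂ (suc l) (σ′ ++ [ suc l ]) × P′ ≡ Φ (σ′ ++ [ suc l ]) × P″ ≡ Φ (renorm σ″)
identification {σ″ = []} _ _ _ _ _ σ″≢[] = ⊥-elim (σ″≢[] refl)
identification {P′ = P′} {P″} {σ″ = y ∷ ys} σ-class eΦ |P′|≡2l eq perm′ σ″≢[]
  with decomposition (proj₁ σ-class) eq perm′ σ″≢[]
... | split , _ , |Φτ|≡2l , _ =
  append-max-class σ-class eq perm′ ,
  ++-split-unique P′ P″ _ _ (trans (sym eΦ) split) (trans |P′|≡2l (sym |Φτ|≡2l))

proposition5 : ∀ (n : ℕ) (σ : List ℕ) → InAvT₁∪T₂ (suc n) σ → ∀ (l : ℕ) →
    ((∃[ P′ ] ∃[ P″ ] (Φ σ ≡ P′ ++ P″ × DyckPath P′ × length P′ ≡ 2 * l × DyckPrefix P″))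
      ⇔ (∃[ σ′ ] ∃[ σ″ ] (σ ≡ σ′ ++ σ″ × IsPerm l σ′ × σ″ ≢ [])))
    × (∀ (P′ P″ : List Step) (σ′ σ″ : List ℕ) →
        Φ σ ≡ P′ ++ P″ → DyckPath P′ → length P′ ≡ 2 * l → DyckPrefix P″ →
        σ ≡ σ′ ++ σ″ → IsPerm l σ′ → σ″ ≢ [] →
        InAvT₁∪T₂ (suc l) (σ′ ++ [ suc l ])
          × P′ ≡ Φ (σ′ ++ [ suc l ])
          × P″ ≡ Φ (renorm σ″))
proposition5 n σ σ-class l =
  mk⇔ (λ { (_ , _ , eΦ , P′-path , |P′|≡2l , _) → Φ-return (proj₁ σ-class) eΦ P′-path |P′|≡2l })
      (λ { (_ , _ , eq , perm′ , σ″≢[]) → _ , _ , decomposition (proj₁ σ-class) eq perm′ σ″≢[] }) ,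
  λ P′ P″ σ′ σ″ eΦ _ |P′|≡2l _ eq perm′ σ″≢[] → identification σ-class eΦ |P′|≡2l eq perm′ σ″≢[]
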